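{- Let $p\geq 1$ and $n\ge 0$ be integers. Then the cube polynomial $C_{\Gamma_n^p}(x)$ has degree $\left\lfloor \frac{n+p}{p+1}\right\rfloor$, and $$C_{\Gamma_n^p}(x)=\sum_{a = 0}^{\left\lfloor \frac{n+p}{p+1}\right\rfloor}\binom{n-ap+p}{a}(1+x)^{a}.$$ Moreover, for every $k\geq 0$ the number of induced subgraphs of $\Gamma_n^p$ isomorphic to $Q_k$ is $$c_k(\Gamma_n^p)=\sum_{i = k}^{\left\lfloor \frac{n+p}{p+1}\right\rfloor}\binom{n-ip+p}{i}\binom{i}{k}.$$
   Context: $Q_n$ is the $n$-dimensional hypercube: vertex set $\{0,1\}^n$, two strings adjacent iff they differ in exactly one coordinate. For $p\geq 1$, a Fibonacci $p$-string of length $n$ is a binary string of length $n$ in which any two 1s are separated by at least $p$ 0s. The Fibonacci $p$-cube $\Gamma_n^p$ is the subgraph of $Q_n$ induced by the Fibonacci $p$-strings of length $n$ ($\Gamma_0^p=K_1$, the vertex being the empty string). For a graph $G$, $c_k(G)$ denotes the number of induced subgraphs of $G$ isomorphic to $Q_k$, and the cube polynomial is $C_G(x)=\sum_{k\geq0}c_k(G)x^k$. -}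

module Defs where

open import Data.Bool using (Bool; true; false; T; _≟_; if_then_else_)
open import Data.Nat using (ℕ; zero; suc; _+_; _*_; _∸_; _<_)
open import Data.Nat.Combinatorics using (_C_)
open import Data.Fin using (Fin; toℕ)
open import Data.Vec using (Vec; []; _∷_; lookup)
open import Data.List using (List; []; _∷_; length; map; applyUpTo)
open import Data.Nat.ListAction using (sum)
open import Data.List.Membership.Propositional using (_∈_)
open import Data.List.Relation.Unary.Unique.Propositional using (Unique)
open import Data.Product using (Σ; _×_; ∃; _,_)
open import Function.Bundles using (_⇔_)
open import Relation.Binary.PropositionalEquality using (_≡_)
open import Relation.Nullary using (does)

hamming : ∀ {n} → Vec Bool n → Vec Bool n → ℕ
hamming []       []       = 0
hamming (a ∷ u)  (b ∷ v)  = (if does (a ≟ b) then 0 else 1) + hamming u v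

Adj : ∀ {n} → Vec Bool n → Vec Bool n → Set
Adj u v = hamming u v ≡ 1

-- Fibonacci p-strings: any two 1s (at positions i < j) are separated by
-- at least p 0s, i.e. j - i ≥ p + 1.

FibString : (p : ℕ) → ∀ {n} → Vec Bool n → Set
FibString p {n} v = (i j : Fin n) → toℕ i < toℕ j →
  lookup v i ≡ true → lookup v j ≡ true → p < toℕ j ∸ toℕ i

-- Finite subsets of {0,1}^n, represented as complete binary tries
-- (so propositional equality is extensional equality of subsets).

VSet : ℕ → Set
VSet zero    = Bool
VSet (suc n) = VSet n × VSet n

infix 4 _∈V_
_∈V_ : ∀ {n} → Vec Bool n → VSet n → Set
_∈V_ []            b       = T b
_∈V_ (false ∷ v)   (l , r) = v ∈V l
_∈V_ (true  ∷ v)   (l , r) = v ∈V r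

-- S ⊆ V(Γ_n^p) induces a subgraph of Γ_n^p isomorphic to Q_k:
-- S consists of Fibonacci p-strings and there is a bijection
-- f : V(Q_k) → S preserving and reflecting adjacency (adjacency in
-- the induced subgraph Γ_n^p[S] is adjacency in Q_n).

InducedQk : (p n k : ℕ) → VSet n → Set
InducedQk p n k S =
  (∀ (v : Vec Bool n) → v ∈V S → FibString p v) ×
  Σ (Vec Bool k → Vec Bool n) λ f →
    (∀ x → f x ∈V S) ×
    (∀ v → v ∈V S → ∃ λ x → f x ≡ v) ×
    (∀ x y → f x ≡ f y → x ≡ y) ×
    (∀ x y → Adj x y ⇔ Adj (f x) (f y))

CountIs : {A : Set} → (A → Set) → ℕ → Set
CountIs {A} P m = Σ (List A) λ xs →
  Unique xs × (∀ a → a ∈ xs ⇔ P a) × length xs ≡ m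

cCount : (p n k m : ℕ) → Set
cCount p n k m = CountIs (InducedQk p n k) m

-- Polynomials over ℕ as little-endian coefficient lists.

Poly : Set
Poly = List ℕ

infixl 6 _+P_
_+P_ : Poly → Poly → Poly
[]       +P q        = q
(a ∷ p)  +P []       = a ∷ p
(a ∷ p)  +P (b ∷ q)  = (a + b) ∷ (p +P q)

scaleP : ℕ → Poly → Poly
scaleP c = map (c *_)

infixl 7 _*P_
_*P_ : Poly → Poly → Poly
[]      *P q = []
(a ∷ p) *P q = scaleP a q +P (0 ∷ (p *P q))

onePlusXPow : ℕ → Poly
onePlusXPow zero    = 1 ∷ []
onePlusXPow (suc a) = (1 ∷ 1 ∷ []) *P onePlusXPow a

coeff : Poly → ℕ → ℕ
coeff []      _       = 0
coeff (a ∷ p) zero    = a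
coeff (a ∷ p) (suc k) = coeff p k

-- Σ_{i=lo}^{hi} f i   (empty if hi < lo)
sumFromTo : ℕ → ℕ → (ℕ → ℕ) → ℕ
sumFromTo lo hi f = sum (applyUpTo (λ j → f (lo + j)) (suc hi ∸ lo))

polySumTo : ℕ → (ℕ → Poly) → Poly
polySumTo zero    q = q 0
polySumTo (suc d) q = polySumTo d q +P q (suc d)

open import Data.Nat using (_/_)

degBound : ℕ → ℕ → ℕ
degBound p n = (n + p) / suc p

cubePolyRHS : ℕ → ℕ → Poly
cubePolyRHS p n = polySumTo (degBound p n)
  (λ a → scaleP (((n + p) ∸ a * p) C a) (onePlusXPow a))

ckRHS : ℕ → ℕ → ℕ → ℕ
ckRHS p n k = sumFromTo k (degBound p n) (λ i → (((n + p) ∸ i * p) C i) * (i C k))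

{-# OPTIONS --safe #-}

-- A subcube of Q_n is given by a pattern in {0,1,⋆}^n. It lies in Γ_n^p iff its top vertex (every ⋆
-- read as 1) is a Fibonacci p-string, because turning 1s into 0s preserves Fibonacci strings.
-- Conversely every induced Q_k of Q_n is a subcube: every square of Q_n has parallel opposite edges,
-- so the two halves x ↦ f (0x) and x ↦ f (1x) of an embedding f differ in one fixed coordinate, and
-- induction on k applies. A Fibonacci pattern with k stars is a Fibonacci string with a ones, of which
-- there are binom(n - ap + p, a), together with k of its ones turned into stars; this count is checked
-- against the recursion on the first letter of the pattern, using Pascal's rule. The coefficients of
-- (1 + x)^a are binom(a, k), and the terms with a > ⌊(n+p)/(p+1)⌋ vanish while the top one is positive.

module Submission where

open import Algebra.Properties.CommutativeSemigroup as CommSemigroupProperties using ()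
open import Data.Bool using (Bool; true; false; not)
open import Data.Bool.Properties using (not-involutive; not-¬; ¬-not)
open import Data.Empty using (⊥)
open import Data.Fin using (Fin; zero; suc; toℕ) renaming (_≟_ to _≟ᶠ_)
open import Data.List as List using (List; []; _∷_; [_]; _++_; _∷ʳ_; length; applyUpTo)
open import Data.List.Membership.Propositional using (_∈_)
open import Data.List.Membership.Propositional.Properties using (∈-map⁺; ∈-map⁻; ∈-++⁺ˡ; ∈-++⁺ʳ; ∈-++⁻)
open import Data.List.Properties using (applyUpTo-∷ʳ; length-map; length-++)
open import Data.List.Relation.Binary.Disjoint.Propositional using (Disjoint)
open import Data.List.Relation.Unary.All using ([])
open import Data.List.Relation.Unary.AllPairs using ([]; _∷_)
open import Data.List.Relation.Unary.Any using (here)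
open import Data.List.Relation.Unary.Unique.Propositional using (Unique)
import Data.List.Relation.Unary.Unique.Propositional.Properties as Unique
open import Data.Nat using (ℕ; zero; suc; _+_; _*_; _∸_; _≤_; _<_; z≤n; s≤s; z<s; s<s; s≤s⁻¹; s<s⁻¹)
open import Data.Nat.Combinatorics using (_C_; nCn≡1; nCk+nC[k+1]≡[n+1]C[k+1]; k>n⇒nCk≡0)
open import Data.Nat.DivMod using (m/n*n≤m; m*n/n≡m; /-monoˡ-≤)
open import Data.Nat.ListAction using (sum)
open import Data.Nat.ListAction.Properties using (sum-++)
open import Data.Nat.Properties
  using (_≤?_; <⇒≤; +-comm; +-assoc; +-identityʳ; *-identityˡ; *-identityʳ; *-zeroʳ; *-suc; *-distribˡ-+; *-distribʳ-+;
         +-commutativeSemigroup; ≤-trans; <-trans; <-≤-trans; <⇒≱; ≮⇒≥; ≰⇒>; n<1+n; m≤m+n; m≤n+m; suc-injective;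
         m<n⇒n≢0; +-∸-assoc; m∸n≤m; m≤n⇒m∸n≡0; m+n∸n≡m; m+n≤o⇒m≤o∸n; m<n+o⇒m∸n<o; [m+n]∸[m+o]≡n∸o)
open import Data.Product using (Σ; ∃; _×_; _,_; proj₁; proj₂)
import Data.Product as Product
open import Data.Sum using (_⊎_; inj₁; inj₂)
import Data.Sum as Sum
open import Data.Unit using (⊤; tt)
open import Data.Vec as Vec using (Vec; []; _∷_; lookup; updateAt; replicate; _[_]≔_)
open import Data.Vec.Properties
  using (∷-injective; ∷-injectiveʳ; lookup-map; lookup∘update; updateAt-updateAt; updateAt-cong; updateAt-id;
         updateAt-commutes; lookup∘updateAt; lookup∘updateAt′)
open import Data.Vec.Relation.Binary.Pointwise.Inductive as Pointwise using (Pointwise; []; _∷_)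
open import Function.Base using (_∘_)
open import Function.Bundles using (_⇔_; mk⇔; Equivalence)
open import Function.Definitions using (Injective)
open import Relation.Binary.PropositionalEquality
  using (_≡_; _≢_; refl; sym; trans; cong; cong₂; subst; module ≡-Reasoning)
open import Relation.Nullary using (¬_; Dec; yes; no; contradiction)

open import Defs

open CommSemigroupProperties +-commutativeSemigroup using (interchange)
open ≡-Reasoning

-- Finite sums, binomial coefficients and counting

∑< : ℕ → (ℕ → ℕ) → ℕ
∑< n f = sum (applyUpTo f n)

syntax ∑< n (λ i → e) = ∑[ i < n ] e
infixl 10 ∑<

∑<-cong : ∀ n {f g : ℕ → ℕ} → (∀ i → f i ≡ g i) → ∑< n f ≡ ∑< n g
∑<-cong zero    f≗g = refl
∑<-cong (suc n) f≗g = cong₂ _+_ (f≗g 0) (∑<-cong n (f≗g ∘ suc))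

∑<-zero : ∀ n {f : ℕ → ℕ} → (∀ i → f i ≡ 0) → ∑< n f ≡ 0
∑<-zero zero    f≗0 = refl
∑<-zero (suc n) f≗0 = cong₂ _+_ (f≗0 0) (∑<-zero n (f≗0 ∘ suc))

∑<-+ : ∀ n (f g : ℕ → ℕ) → ∑[ i < n ] (f i + g i) ≡ ∑< n f + ∑< n g
∑<-+ zero    f g = refl
∑<-+ (suc n) f g = begin
  f 0 + g 0 + ∑[ i < n ] (f (suc i) + g (suc i))   ≡⟨ cong (f 0 + g 0 +_) (∑<-+ n (f ∘ suc) (g ∘ suc)) ⟩
  f 0 + g 0 + (∑< n (f ∘ suc) + ∑< n (g ∘ suc))   ≡⟨ interchange (f 0) (g 0) _ _ ⟩
  ∑< (suc n) f + ∑< (suc n) g                     ∎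

∑<-suc : ∀ n (f : ℕ → ℕ) → ∑< (suc n) f ≡ ∑< n f + f n
∑<-suc n f = begin
  sum (applyUpTo f (suc n))      ≡⟨ cong sum (applyUpTo-∷ʳ f n) ⟨
  sum (applyUpTo f n ∷ʳ f n)     ≡⟨ sum-++ (applyUpTo f n) [ f n ] ⟩
  ∑< n f + (f n + 0)             ≡⟨ cong (∑< n f +_) (+-identityʳ (f n)) ⟩
  ∑< n f + f n                   ∎

∑<-vanishing-tail : ∀ m n (f : ℕ → ℕ) → m ≤ n → (∀ i → m ≤ i → f i ≡ 0) → ∑< n f ≡ ∑< m f
∑<-vanishing-tail zero    n       f _         f≡0 = ∑<-zero n (λ i → f≡0 i z≤n)
∑<-vanishing-tail (suc m) (suc n) f (s≤s m≤n) f≡0 =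
  cong (f 0 +_) (∑<-vanishing-tail m n (f ∘ suc) m≤n (λ i m≤i → f≡0 (suc i) (s≤s m≤i)))

∑<-vanishing-head : ∀ k n (f : ℕ → ℕ) → (∀ i → i < k → f i ≡ 0) → ∑< n f ≡ ∑[ j < n ∸ k ] f (k + j)
∑<-vanishing-head zero    n       f f≡0 = refl
∑<-vanishing-head (suc k) zero    f f≡0 = refl
∑<-vanishing-head (suc k) (suc n) f f≡0 = cong₂ _+_ (f≡0 0 z<s)
  (∑<-vanishing-head k n (f ∘ suc) (λ i i<k → f≡0 (suc i) (s<s i<k)))

pascal : ∀ n k → suc n C suc k ≡ n C suc k + n C k
pascal n k = trans (sym (nCk+nC[k+1]≡[n+1]C[k+1] n k)) (+-comm (n C k) (n C suc k))

k≤n⇒0<nCk : ∀ {n k} → k ≤ n → 0 < n C k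
k≤n⇒0<nCk {n}     {zero}  _         = z<s
k≤n⇒0<nCk {suc n} {suc k} (s≤s k≤n) =
  subst (0 <_) (sym (pascal n k)) (<-≤-trans (k≤n⇒0<nCk k≤n) (m≤n+m (n C k) (n C suc k)))

∑-*-pascal : ∀ B (c : ℕ → ℕ) k →
             ∑[ a < B ] (c a * (suc a C suc k)) ≡ ∑[ a < B ] (c a * (a C suc k)) + ∑[ a < B ] (c a * (a C k))
∑-*-pascal B c k = begin
  ∑[ a < B ] (c a * (suc a C suc k))
    ≡⟨ ∑<-cong B (λ a → cong (c a *_) (pascal a k)) ⟩
  ∑[ a < B ] (c a * (a C suc k + a C k))
    ≡⟨ ∑<-cong B (λ a → *-distribˡ-+ (c a) (a C suc k) (a C k)) ⟩
  ∑[ a < B ] (c a * (a C suc k) + c a * (a C k))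
    ≡⟨ ∑<-+ B (λ a → c a * (a C suc k)) (λ a → c a * (a C k)) ⟩
  ∑[ a < B ] (c a * (a C suc k)) + ∑[ a < B ] (c a * (a C k))
    ∎

CountIs-map : ∀ {A B : Set} {P : B → Set} (f : A → B) → Injective _≡_ _≡_ f → {xs : List A} → Unique xs →
              (∀ {a} → a ∈ xs → P (f a)) → (∀ {b} → P b → ∃ λ a → a ∈ xs × b ≡ f a) →
              CountIs P (length xs)
CountIs-map {P = P} f f-injective {xs} unique sound complete =
  List.map f xs , Unique.map⁺ f-injective unique , (λ b → mk⇔ ∈⇒P (P⇒∈ b)) , length-map f xs
  where
  ∈⇒P : ∀ {b} → b ∈ List.map f xs → P b
  ∈⇒P b∈ with ∈-map⁻ f b∈
  ... | a , a∈xs , refl = sound a∈xs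
  P⇒∈ : ∀ b → P b → b ∈ List.map f xs
  P⇒∈ b Pb with complete Pb
  ... | a , a∈xs , refl = ∈-map⁺ f a∈xs

-- Coefficients of polynomials

coeff-+P : ∀ f g k → coeff (f +P g) k ≡ coeff f k + coeff g k
coeff-+P []      g       k       = refl
coeff-+P (a ∷ f) []      k       = sym (+-identityʳ (coeff (a ∷ f) k))
coeff-+P (a ∷ f) (b ∷ g) zero    = refl
coeff-+P (a ∷ f) (b ∷ g) (suc k) = coeff-+P f g k

coeff-scaleP : ∀ c f k → coeff (scaleP c f) k ≡ c * coeff f k
coeff-scaleP c []      k       = sym (*-zeroʳ c)
coeff-scaleP c (a ∷ f) zero    = refl
coeff-scaleP c (a ∷ f) (suc k) = coeff-scaleP c f k

coeff-[0] : ∀ k → coeff (0 ∷ []) k ≡ 0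
coeff-[0] zero    = refl
coeff-[0] (suc k) = refl

coeff-[1+x]*P : ∀ f k → coeff ((1 ∷ 1 ∷ []) *P f) k ≡ coeff f k + coeff (0 ∷ f) k
coeff-[1+x]*P f k = begin
  coeff (scaleP 1 f +P (0 ∷ (scaleP 1 f +P (0 ∷ [])))) k
    ≡⟨ coeff-+P (scaleP 1 f) _ k ⟩
  coeff (scaleP 1 f) k + coeff (0 ∷ (scaleP 1 f +P (0 ∷ []))) k
    ≡⟨ cong₂ _+_ (coeff-scaleP-1 k) (coeff-x* k) ⟩
  coeff f k + coeff (0 ∷ f) k
    ∎
  where
  coeff-scaleP-1 : ∀ k → coeff (scaleP 1 f) k ≡ coeff f k
  coeff-scaleP-1 k = trans (coeff-scaleP 1 f k) (*-identityˡ (coeff f k))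
  coeff-x* : ∀ k → coeff (0 ∷ (scaleP 1 f +P (0 ∷ []))) k ≡ coeff (0 ∷ f) k
  coeff-x* zero    = refl
  coeff-x* (suc k) = begin
    coeff (scaleP 1 f +P (0 ∷ [])) k          ≡⟨ coeff-+P (scaleP 1 f) (0 ∷ []) k ⟩
    coeff (scaleP 1 f) k + coeff (0 ∷ []) k   ≡⟨ cong₂ _+_ (coeff-scaleP-1 k) (coeff-[0] k) ⟩
    coeff f k + 0                             ≡⟨ +-identityʳ (coeff f k) ⟩
    coeff f k                                 ∎

coeff-onePlusXPow : ∀ a k → coeff (onePlusXPow a) k ≡ a C k
coeff-onePlusXPow zero    zero    = refl
coeff-onePlusXPow zero    (suc k) = refl
coeff-onePlusXPow (suc a) zero    =
  trans (coeff-[1+x]*P (onePlusXPow a) 0) (trans (+-identityʳ _) (coeff-onePlusXPow a 0))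
coeff-onePlusXPow (suc a) (suc k) = begin
  coeff (onePlusXPow (suc a)) (suc k)
    ≡⟨ coeff-[1+x]*P (onePlusXPow a) (suc k) ⟩
  coeff (onePlusXPow a) (suc k) + coeff (onePlusXPow a) k
    ≡⟨ cong₂ _+_ (coeff-onePlusXPow a (suc k)) (coeff-onePlusXPow a k) ⟩
  a C suc k + a C k
    ≡⟨ pascal a k ⟨
  suc a C suc k
    ∎

coeff-polySumTo : ∀ d q k → coeff (polySumTo d q) k ≡ ∑[ a < suc d ] coeff (q a) k
coeff-polySumTo zero    q k = sym (+-identityʳ (coeff (q 0) k))
coeff-polySumTo (suc d) q k = begin
  coeff (polySumTo d q +P q (suc d)) k
    ≡⟨ coeff-+P (polySumTo d q) (q (suc d)) k ⟩
  coeff (polySumTo d q) k + coeff (q (suc d)) k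
    ≡⟨ cong (_+ coeff (q (suc d)) k) (coeff-polySumTo d q k) ⟩
  ∑[ a < suc d ] coeff (q a) k + coeff (q (suc d)) k
    ≡⟨ ∑<-suc (suc d) (λ a → coeff (q a) k) ⟨
  ∑[ a < suc (suc d) ] coeff (q a) k
    ∎

-- The hypercube

flipAt : ∀ {n} → Vec Bool n → Fin n → Vec Bool n
flipAt v i = updateAt v i not

flipAt-involutive : ∀ {n} (v : Vec Bool n) i → flipAt (flipAt v i) i ≡ v
flipAt-involutive v i = begin
  updateAt (updateAt v i not) i not   ≡⟨ updateAt-updateAt i v ⟩
  updateAt v i (not ∘ not)            ≡⟨ updateAt-cong i not-involutive v ⟩
  updateAt v i (λ b → b)              ≡⟨ updateAt-id i v ⟩
  v                                   ∎

hamming-refl : ∀ {n} (v : Vec Bool n) → hamming v v ≡ 0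
hamming-refl []          = refl
hamming-refl (false ∷ v) = hamming-refl v
hamming-refl (true ∷ v)  = hamming-refl v

hamming≡0⇒≡ : ∀ {n} {u v : Vec Bool n} → hamming u v ≡ 0 → u ≡ v
hamming≡0⇒≡ {u = []}        {[]}        _ = refl
hamming≡0⇒≡ {u = false ∷ u} {false ∷ v} h = cong (false ∷_) (hamming≡0⇒≡ h)
hamming≡0⇒≡ {u = true ∷ u}  {true ∷ v}  h = cong (true ∷_) (hamming≡0⇒≡ h)

Adj-∷ : ∀ {n} b (u v : Vec Bool n) → Adj u v → Adj (b ∷ u) (b ∷ v)
Adj-∷ false u v h = h
Adj-∷ true  u v h = h

Adj-∷-not : ∀ {n} b (v : Vec Bool n) → Adj (b ∷ v) (not b ∷ v)
Adj-∷-not false v = cong suc (hamming-refl v)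
Adj-∷-not true  v = cong suc (hamming-refl v)

Adj⇒flipAt : ∀ {n} {u v : Vec Bool n} → Adj u v → ∃ λ i → v ≡ flipAt u i
Adj⇒flipAt {u = []}        {[]}        ()
Adj⇒flipAt {u = false ∷ u} {false ∷ v} h with Adj⇒flipAt h
... | i , v≡ = suc i , cong (false ∷_) v≡
Adj⇒flipAt {u = true ∷ u}  {true ∷ v}  h with Adj⇒flipAt h
... | i , v≡ = suc i , cong (true ∷_) v≡
Adj⇒flipAt {u = false ∷ u} {true ∷ v}  h = zero , cong (true ∷_) (sym (hamming≡0⇒≡ (suc-injective h)))
Adj⇒flipAt {u = true ∷ u}  {false ∷ v} h = zero , cong (false ∷_) (sym (hamming≡0⇒≡ (suc-injective h)))

cube-connected : ∀ {k} (P : Vec Bool k → Set) → (∀ x y → Adj x y → P x → P y) →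
                 ∀ x y → P x → P y
cube-connected {zero}  P step []      []      Px = Px
cube-connected {suc k} P step (a ∷ x) (b ∷ y) Px =
  across a b (cube-connected (λ z → P (a ∷ z)) (λ u v → step _ _ ∘ Adj-∷ a u v) x y Px)
  where
  across : ∀ a b → P (a ∷ y) → P (b ∷ y)
  across false false Py = Py
  across true  true  Py = Py
  across false true  Py = step _ _ (Adj-∷-not false y) Py
  across true  false Py = step _ _ (Adj-∷-not true y) Py

square-parallel : ∀ {n} {a₀ a₁ b₀ b₁ : Vec Bool n} {q} → a₁ ≡ flipAt a₀ q →
                  Adj a₀ b₀ → Adj a₁ b₁ → Adj b₀ b₁ → a₁ ≢ b₀ → b₁ ≢ a₀ → b₁ ≡ flipAt b₀ q
square-parallel {a₀ = a₀} {a₁} {b₀} {b₁} {q} a₁≡ a₀~b₀ a₁~b₁ b₀~b₁ a₁≢b₀ b₁≢a₀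
  with Adj⇒flipAt a₀~b₀ | Adj⇒flipAt a₁~b₁ | Adj⇒flipAt b₀~b₁
... | s , b₀≡ | r , b₁≡ | t , b₁≡′ = begin
  b₁                          ≡⟨ b₁≡ ⟩
  flipAt a₁ r                 ≡⟨ cong₂ flipAt a₁≡ r≡s ⟩
  flipAt (flipAt a₀ q) s      ≡⟨ updateAt-commutes s q (q≢s ∘ sym) a₀ ⟩
  flipAt (flipAt a₀ s) q      ≡⟨ cong (λ v → flipAt v q) b₀≡ ⟨
  flipAt b₀ q                 ∎
  where
  q≢s : q ≢ s
  q≢s q≡s = a₁≢b₀ (trans a₁≡ (trans (cong (flipAt a₀) q≡s) (sym b₀≡)))
  t≢s : t ≢ s
  t≢s t≡s = b₁≢a₀ (trans b₁≡′ (trans (cong₂ flipAt b₀≡ t≡s) (flipAt-involutive a₀ s)))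
  -- Otherwise coordinate s is flipped once along a₀ b₀ b₁ but never along a₀ a₁ b₁.
  r≡s : r ≡ s
  r≡s with r ≟ᶠ s
  ... | yes r≡s = r≡s
  ... | no  r≢s = contradiction (begin
    lookup a₀ s                 ≡⟨ lookup∘updateAt′ s q (q≢s ∘ sym) a₀ ⟨
    lookup (flipAt a₀ q) s      ≡⟨ cong (λ v → lookup v s) a₁≡ ⟨
    lookup a₁ s                 ≡⟨ lookup∘updateAt′ s r (r≢s ∘ sym) a₁ ⟨
    lookup (flipAt a₁ r) s      ≡⟨ cong (λ v → lookup v s) (trans (sym b₁≡) b₁≡′) ⟩
    lookup (flipAt b₀ t) s      ≡⟨ lookup∘updateAt′ s t (t≢s ∘ sym) b₀ ⟩
    lookup b₀ s                 ≡⟨ cong (λ v → lookup v s) b₀≡ ⟩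
    lookup (flipAt a₀ s) s      ≡⟨ lookup∘updateAt s a₀ ⟩
    not (lookup a₀ s)           ∎) (not-¬ refl)

-- Subcubes as patterns over {0,1,⋆}

data Letter : Set where
  𝟎 𝟏 ⋆ : Letter

Pattern : ℕ → Set
Pattern = Vec Letter

data _∈ᴸ_ : Bool → Letter → Set where
  0∈𝟎 : false ∈ᴸ 𝟎
  1∈𝟏 : true ∈ᴸ 𝟏
  b∈⋆ : ∀ {b} → b ∈ᴸ ⋆

infix 4 _∈ᴸ_ _∈ᴾ_

_∈ᴾ_ : ∀ {n} → Vec Bool n → Pattern n → Set
_∈ᴾ_ = Pointwise _∈ᴸ_

∈ᴸ⊎not∈ᴸ : ∀ l b → b ∈ᴸ l ⊎ not b ∈ᴸ l
∈ᴸ⊎not∈ᴸ 𝟎 false = inj₁ 0∈𝟎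
∈ᴸ⊎not∈ᴸ 𝟎 true  = inj₂ 0∈𝟎
∈ᴸ⊎not∈ᴸ 𝟏 false = inj₂ 1∈𝟏
∈ᴸ⊎not∈ᴸ 𝟏 true  = inj₁ 1∈𝟏
∈ᴸ⊎not∈ᴸ ⋆ b     = inj₁ b∈⋆

dim : ∀ {n} → Pattern n → ℕ
dim []      = 0
dim (𝟎 ∷ w) = dim w
dim (𝟏 ∷ w) = dim w
dim (⋆ ∷ w) = suc (dim w)

topLetter : Letter → Bool
topLetter 𝟎 = false
topLetter 𝟏 = true
topLetter ⋆ = true

top : ∀ {n} → Pattern n → Vec Bool n
top = Vec.map topLetter

top-∈ᴾ : ∀ {n} (w : Pattern n) → top w ∈ᴾ w
top-∈ᴾ []      = []
top-∈ᴾ (𝟎 ∷ w) = 0∈𝟎 ∷ top-∈ᴾ w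
top-∈ᴾ (𝟏 ∷ w) = 1∈𝟏 ∷ top-∈ᴾ w
top-∈ᴾ (⋆ ∷ w) = b∈⋆ ∷ top-∈ᴾ w

∈ᴾ⇒≤top : ∀ {n} {v : Vec Bool n} {w} → v ∈ᴾ w → ∀ i → lookup v i ≡ true → lookup (top w) i ≡ true
∈ᴾ⇒≤top {w = w} v∈w i v[i]≡true =
  trans (lookup-map i topLetter w) (≤topLetter (Pointwise.lookup v∈w i) v[i]≡true)
  where
  ≤topLetter : ∀ {b l} → b ∈ᴸ l → b ≡ true → topLetter l ≡ true
  ≤topLetter 1∈𝟏 _ = refl
  ≤topLetter b∈⋆ _ = refl

embed : ∀ {n} (w : Pattern n) → Vec Bool (dim w) → Vec Bool n
embed []      x       = []
embed (𝟎 ∷ w) x       = false ∷ embed w x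
embed (𝟏 ∷ w) x       = true ∷ embed w x
embed (⋆ ∷ w) (b ∷ x) = b ∷ embed w x

embed-∈ᴾ : ∀ {n} (w : Pattern n) x → embed w x ∈ᴾ w
embed-∈ᴾ []      x       = []
embed-∈ᴾ (𝟎 ∷ w) x       = 0∈𝟎 ∷ embed-∈ᴾ w x
embed-∈ᴾ (𝟏 ∷ w) x       = 1∈𝟏 ∷ embed-∈ᴾ w x
embed-∈ᴾ (⋆ ∷ w) (b ∷ x) = b∈⋆ ∷ embed-∈ᴾ w x

embed-surjective : ∀ {n} {w : Pattern n} {v} → v ∈ᴾ w → ∃ λ x → embed w x ≡ v
embed-surjective []              = [] , refl
embed-surjective (0∈𝟎 ∷ v∈w)     = Product.map₂ (cong (false ∷_)) (embed-surjective v∈w)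
embed-surjective (1∈𝟏 ∷ v∈w)     = Product.map₂ (cong (true ∷_)) (embed-surjective v∈w)
embed-surjective (b∈⋆ {b} ∷ v∈w) = Product.map (b ∷_) (cong (b ∷_)) (embed-surjective v∈w)

embed-injective : ∀ {n} (w : Pattern n) {x y} → embed w x ≡ embed w y → x ≡ y
embed-injective []      {[]}    {[]}    _  = refl
embed-injective (𝟎 ∷ w)                 eq = embed-injective w (proj₂ (∷-injective eq))
embed-injective (𝟏 ∷ w)                 eq = embed-injective w (proj₂ (∷-injective eq))
embed-injective (⋆ ∷ w) {a ∷ x} {b ∷ y} eq =
  cong₂ _∷_ (proj₁ (∷-injective eq)) (embed-injective w (proj₂ (∷-injective eq)))

hamming-embed : ∀ {n} (w : Pattern n) x y → hamming (embed w x) (embed w y) ≡ hamming x y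
hamming-embed []      []      []      = refl
hamming-embed (𝟎 ∷ w) x       y       = hamming-embed w x y
hamming-embed (𝟏 ∷ w) x       y       = hamming-embed w x y
hamming-embed (⋆ ∷ w) (a ∷ x) (b ∷ y) = cong (_ +_) (hamming-embed w x y)

∅ : ∀ {n} → VSet n
∅ {zero}  = false
∅ {suc n} = ∅ , ∅

∉∅ : ∀ {n} (v : Vec Bool n) → ¬ v ∈V ∅
∉∅ []          ()
∉∅ (false ∷ v) = ∉∅ v
∉∅ (true ∷ v)  = ∉∅ v

VSet-ext : ∀ {n} (S T : VSet n) → (∀ v → v ∈V S → v ∈V T) → (∀ v → v ∈V T → v ∈V S) → S ≡ T
VSet-ext {zero}  false false S⊆T T⊆S = refl
VSet-ext {zero}  true  true  S⊆T T⊆S = refl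
VSet-ext {zero}  false true  S⊆T T⊆S = contradiction (T⊆S [] tt) λ ()
VSet-ext {zero}  true  false S⊆T T⊆S = contradiction (S⊆T [] tt) λ ()
VSet-ext {suc n} (S₀ , S₁) (T₀ , T₁) S⊆T T⊆S =
  cong₂ _,_ (VSet-ext S₀ T₀ (S⊆T ∘ (false ∷_)) (T⊆S ∘ (false ∷_)))
            (VSet-ext S₁ T₁ (S⊆T ∘ (true ∷_))  (T⊆S ∘ (true ∷_)))

⟦_⟧ : ∀ {n} → Pattern n → VSet n
⟦ [] ⟧    = true
⟦ 𝟎 ∷ w ⟧ = ⟦ w ⟧ , ∅
⟦ 𝟏 ∷ w ⟧ = ∅ , ⟦ w ⟧
⟦ ⋆ ∷ w ⟧ = ⟦ w ⟧ , ⟦ w ⟧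

∈V⟦⟧⇒∈ᴾ : ∀ {n} (w : Pattern n) v → v ∈V ⟦ w ⟧ → v ∈ᴾ w
∈V⟦⟧⇒∈ᴾ []      []          _ = []
∈V⟦⟧⇒∈ᴾ (𝟎 ∷ w) (false ∷ v) m = 0∈𝟎 ∷ ∈V⟦⟧⇒∈ᴾ w v m
∈V⟦⟧⇒∈ᴾ (𝟎 ∷ w) (true ∷ v)  m = contradiction m (∉∅ v)
∈V⟦⟧⇒∈ᴾ (𝟏 ∷ w) (false ∷ v) m = contradiction m (∉∅ v)
∈V⟦⟧⇒∈ᴾ (𝟏 ∷ w) (true ∷ v)  m = 1∈𝟏 ∷ ∈V⟦⟧⇒∈ᴾ w v m
∈V⟦⟧⇒∈ᴾ (⋆ ∷ w) (false ∷ v) m = b∈⋆ ∷ ∈V⟦⟧⇒∈ᴾ w v m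
∈V⟦⟧⇒∈ᴾ (⋆ ∷ w) (true ∷ v)  m = b∈⋆ ∷ ∈V⟦⟧⇒∈ᴾ w v m

∈ᴾ⇒∈V⟦⟧ : ∀ {n} {v : Vec Bool n} {w} → v ∈ᴾ w → v ∈V ⟦ w ⟧
∈ᴾ⇒∈V⟦⟧ []                          = tt
∈ᴾ⇒∈V⟦⟧ (0∈𝟎 ∷ v∈w)                 = ∈ᴾ⇒∈V⟦⟧ v∈w
∈ᴾ⇒∈V⟦⟧ (1∈𝟏 ∷ v∈w)                 = ∈ᴾ⇒∈V⟦⟧ v∈w
∈ᴾ⇒∈V⟦⟧ {v = false ∷ _} (b∈⋆ ∷ v∈w) = ∈ᴾ⇒∈V⟦⟧ v∈w
∈ᴾ⇒∈V⟦⟧ {v = true ∷ _}  (b∈⋆ ∷ v∈w) = ∈ᴾ⇒∈V⟦⟧ v∈w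

⟦⟧≢∅ : ∀ {n} (w : Pattern n) → ⟦ w ⟧ ≢ ∅
⟦⟧≢∅ w eq = ∉∅ (top w) (subst (top w ∈V_) eq (∈ᴾ⇒∈V⟦⟧ (top-∈ᴾ w)))

⟦⟧-injective : ∀ {n} (w w′ : Pattern n) → ⟦ w ⟧ ≡ ⟦ w′ ⟧ → w ≡ w′
⟦⟧-injective []      []       _  = refl
⟦⟧-injective (𝟎 ∷ w) (𝟎 ∷ w′) eq = cong (𝟎 ∷_) (⟦⟧-injective w w′ (cong proj₁ eq))
⟦⟧-injective (𝟏 ∷ w) (𝟏 ∷ w′) eq = cong (𝟏 ∷_) (⟦⟧-injective w w′ (cong proj₂ eq))
⟦⟧-injective (⋆ ∷ w) (⋆ ∷ w′) eq = cong (⋆ ∷_) (⟦⟧-injective w w′ (cong proj₁ eq))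
⟦⟧-injective (𝟎 ∷ w) (𝟏 ∷ w′) eq = contradiction (cong proj₁ eq) (⟦⟧≢∅ w)
⟦⟧-injective (𝟎 ∷ w) (⋆ ∷ w′) eq = contradiction (sym (cong proj₂ eq)) (⟦⟧≢∅ w′)
⟦⟧-injective (𝟏 ∷ w) (𝟎 ∷ w′) eq = contradiction (cong proj₂ eq) (⟦⟧≢∅ w)
⟦⟧-injective (𝟏 ∷ w) (⋆ ∷ w′) eq = contradiction (sym (cong proj₁ eq)) (⟦⟧≢∅ w′)
⟦⟧-injective (⋆ ∷ w) (𝟎 ∷ w′) eq = contradiction (cong proj₂ eq) (⟦⟧≢∅ w)
⟦⟧-injective (⋆ ∷ w) (𝟏 ∷ w′) eq = contradiction (cong proj₁ eq) (⟦⟧≢∅ w)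

vertexPattern : ∀ {n} → Vec Bool n → Pattern n
vertexPattern []          = []
vertexPattern (false ∷ u) = 𝟎 ∷ vertexPattern u
vertexPattern (true ∷ u)  = 𝟏 ∷ vertexPattern u

dim-vertexPattern : ∀ {n} (u : Vec Bool n) → dim (vertexPattern u) ≡ 0
dim-vertexPattern []          = refl
dim-vertexPattern (false ∷ u) = dim-vertexPattern u
dim-vertexPattern (true ∷ u)  = dim-vertexPattern u

∈ᴾ-vertexPattern : ∀ {n} (u : Vec Bool n) → u ∈ᴾ vertexPattern u
∈ᴾ-vertexPattern []          = []
∈ᴾ-vertexPattern (false ∷ u) = 0∈𝟎 ∷ ∈ᴾ-vertexPattern u
∈ᴾ-vertexPattern (true ∷ u)  = 1∈𝟏 ∷ ∈ᴾ-vertexPattern u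

∈ᴾ-vertexPattern⁻ : ∀ {n} (u : Vec Bool n) {v} → v ∈ᴾ vertexPattern u → u ≡ v
∈ᴾ-vertexPattern⁻ []          []          = refl
∈ᴾ-vertexPattern⁻ (false ∷ u) (0∈𝟎 ∷ v∈w) = cong (false ∷_) (∈ᴾ-vertexPattern⁻ u v∈w)
∈ᴾ-vertexPattern⁻ (true ∷ u)  (1∈𝟏 ∷ v∈w) = cong (true ∷_) (∈ᴾ-vertexPattern⁻ u v∈w)

∈ᴾ-[]≔⋆⁺ : ∀ {n} {v : Vec Bool n} {w} q → v ∈ᴾ w → v ∈ᴾ w [ q ]≔ ⋆
∈ᴾ-[]≔⋆⁺ zero    (_ ∷ v∈w)   = b∈⋆ ∷ v∈w
∈ᴾ-[]≔⋆⁺ (suc q) (b∈l ∷ v∈w) = b∈l ∷ ∈ᴾ-[]≔⋆⁺ q v∈w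

∈ᴾ-[]≔⋆⁻ : ∀ {n} {v : Vec Bool n} {w} q → v ∈ᴾ w [ q ]≔ ⋆ → v ∈ᴾ w ⊎ flipAt v q ∈ᴾ w
∈ᴾ-[]≔⋆⁻ {v = b ∷ _} {l ∷ _} zero    (_ ∷ v∈w)   = Sum.map (_∷ v∈w) (_∷ v∈w) (∈ᴸ⊎not∈ᴸ l b)
∈ᴾ-[]≔⋆⁻ {w = _ ∷ _}         (suc q) (b∈l ∷ v∈w) = Sum.map (b∈l ∷_) (b∈l ∷_) (∈ᴾ-[]≔⋆⁻ q v∈w)

∈ᴾ-flipAt : ∀ {n} {v : Vec Bool n} {w} q → lookup w q ≡ ⋆ → v ∈ᴾ w → flipAt v q ∈ᴾ w
∈ᴾ-flipAt zero    refl (b∈⋆ ∷ v∈w) = b∈⋆ ∷ v∈w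
∈ᴾ-flipAt (suc q) w[q] (b∈l ∷ v∈w) = b∈l ∷ ∈ᴾ-flipAt q w[q] v∈w

dim-[]≔⋆ : ∀ {n} (w : Pattern n) q → lookup w q ≢ ⋆ → dim (w [ q ]≔ ⋆) ≡ suc (dim w)
dim-[]≔⋆ (𝟎 ∷ w) zero    _    = refl
dim-[]≔⋆ (𝟏 ∷ w) zero    _    = refl
dim-[]≔⋆ (⋆ ∷ w) zero    w[q] = contradiction refl w[q]
dim-[]≔⋆ (𝟎 ∷ w) (suc q) w[q] = dim-[]≔⋆ w q w[q]
dim-[]≔⋆ (𝟏 ∷ w) (suc q) w[q] = dim-[]≔⋆ w q w[q]
dim-[]≔⋆ (⋆ ∷ w) (suc q) w[q] = cong suc (dim-[]≔⋆ w q w[q])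

-- Induced cubes are subcubes

PreservesAdj : ∀ {k n} → (Vec Bool k → Vec Bool n) → Set
PreservesAdj f = ∀ x y → Adj x y → Adj (f x) (f y)

module _ {k n} (f : Vec Bool (suc k) → Vec Bool n) (f-injective : Injective _≡_ _≡_ f) where

  halves-disjoint : ∀ x y → f (true ∷ x) ≢ f (false ∷ y)
  halves-disjoint x y eq with f-injective eq
  ... | ()

  halves-parallel : PreservesAdj f → ∃ λ q → ∀ x → f (true ∷ x) ≡ flipAt (f (false ∷ x)) q
  halves-parallel adj with Adj⇒flipAt (adj _ _ (Adj-∷-not false (replicate k false)))
  ... | q , f₁o≡ = q , λ x → cube-connected P step (replicate k false) x f₁o≡
    where
    P : Vec Bool k → Set
    P x = f (true ∷ x) ≡ flipAt (f (false ∷ x)) q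
    step : ∀ x y → Adj x y → P x → P y
    step x y x~y Px = square-parallel Px (adj _ _ (Adj-∷ false x y x~y)) (adj _ _ (Adj-∷ true x y x~y))
                        (adj _ _ (Adj-∷-not false y)) (halves-disjoint x y) (halves-disjoint y x)

cube-image : ∀ k {n} (f : Vec Bool k → Vec Bool n) → Injective _≡_ _≡_ f → PreservesAdj f →
             ∃ λ w → dim w ≡ k × (∀ v → v ∈ᴾ w ⇔ ∃ λ x → f x ≡ v)
cube-image zero f _ _ = vertexPattern (f []) , dim-vertexPattern (f []) , λ v →
  mk⇔ (λ v∈w → [] , ∈ᴾ-vertexPattern⁻ (f []) v∈w) (λ { ([] , refl) → ∈ᴾ-vertexPattern (f []) })
cube-image (suc k) f f-injective adj
  with cube-image k (f ∘ (false ∷_)) (∷-injectiveʳ ∘ f-injective) (λ x y → adj _ _ ∘ Adj-∷ false x y)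
     | halves-parallel f f-injective adj
... | w , dim-w , image-w | q , f₁≡ =
  w [ q ]≔ ⋆ , trans (dim-[]≔⋆ w q q-fixed) (cong suc dim-w) , λ v → mk⇔ ∈⇒image image⇒∈
  where
  o : Vec Bool k
  o = replicate k false
  q-fixed : lookup w q ≢ ⋆
  q-fixed w[q]≡⋆ with Equivalence.to (image-w _) (∈ᴾ-flipAt q w[q]≡⋆ (Equivalence.from (image-w _) (o , refl)))
  ... | x , f₀x≡ = halves-disjoint f f-injective o x (trans (f₁≡ o) (sym f₀x≡))
  ∈⇒image : ∀ {v} → v ∈ᴾ w [ q ]≔ ⋆ → ∃ λ x → f x ≡ v
  ∈⇒image {v} v∈ with ∈ᴾ-[]≔⋆⁻ q v∈
  ... | inj₁ v∈w with Equivalence.to (image-w v) v∈w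
  ...   | x , f₀x≡v = false ∷ x , f₀x≡v
  ∈⇒image {v} v∈ | inj₂ v′∈w with Equivalence.to (image-w _) v′∈w
  ...   | x , f₀x≡v′ = true ∷ x , trans (f₁≡ x) (trans (cong (λ u → flipAt u q) f₀x≡v′) (flipAt-involutive v q))
  image⇒∈ : ∀ {v} → (∃ λ x → f x ≡ v) → v ∈ᴾ w [ q ]≔ ⋆
  image⇒∈ (false ∷ x , refl) = ∈ᴾ-[]≔⋆⁺ q (Equivalence.from (image-w _) (x , refl))
  image⇒∈ (true ∷ x , refl)  = subst (_∈ᴾ w [ q ]≔ ⋆) (sym (f₁≡ x))
    (∈ᴾ-flipAt q (lookup∘update q w ⋆) (∈ᴾ-[]≔⋆⁺ q (Equivalence.from (image-w _) (x , refl))))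

-- Fibonacci patterns

module _ (p : ℕ) where

  -- β m a = binom(m - a p, a); the coefficient binom(n - a p + p, a) of the theorem is β (n + p) a.
  β : ℕ → ℕ → ℕ
  β m a = (m ∸ a * p) C a

  private
    +p∸p+ : ∀ m y → m + p ∸ (p + y) ≡ m ∸ y
    +p∸p+ m y = trans (cong (_∸ (p + y)) (+-comm m p)) ([m+n]∸[m+o]≡n∸o p m y)

  β-pascal : ∀ m a → β (suc m + p) (suc a) ≡ β (m + p) (suc a) + β m a
  β-pascal m a = begin
    β (suc m + p) (suc a)                   ≡⟨ cong (_C suc a) (+p∸p+ (suc m) (a * p)) ⟩
    (suc m ∸ a * p) C suc a                 ≡⟨ truncated-pascal a (a * p ≤? m) ⟩
    (m ∸ a * p) C suc a + (m ∸ a * p) C a   ≡⟨ cong (λ x → x C suc a + β m a) (+p∸p+ m (a * p)) ⟨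
    β (m + p) (suc a) + β m a               ∎
    where
    truncated-pascal : ∀ a → Dec (a * p ≤ m) →
                       (suc m ∸ a * p) C suc a ≡ (m ∸ a * p) C suc a + (m ∸ a * p) C a
    truncated-pascal a       (yes ap≤m) = trans (cong (_C suc a) (+-∸-assoc 1 ap≤m)) (pascal (m ∸ a * p) a)
    truncated-pascal zero    (no ap≰m)  = contradiction z≤n ap≰m
    truncated-pascal (suc a) (no ap≰m)  =
      trans (cong (_C suc (suc a)) (m≤n⇒m∸n≡0 (≰⇒> ap≰m)))
            (sym (cong (λ x → x C suc (suc a) + x C suc a) (m≤n⇒m∸n≡0 (<⇒≤ (≰⇒> ap≰m)))))

  β-short : ∀ {m} → m ≤ p → ∀ a → β m (suc a) ≡ 0
  β-short m≤p a = cong (_C suc a) (m≤n⇒m∸n≡0 (≤-trans m≤p (m≤m+n p (a * p))))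

  ≤degBound : ∀ {n i} → i * suc p ≤ n + p → i ≤ degBound p n
  ≤degBound {n} {i} h = subst (_≤ degBound p n) (m*n/n≡m i (suc p)) (/-monoˡ-≤ (suc p) h)

  β-vanishes-above-degBound : ∀ n i → degBound p n < i → β (n + p) i ≡ 0
  β-vanishes-above-degBound n (suc i) d<i = k>n⇒nCk≡0 (m<n+o⇒m∸n<o (n + p) (suc i * p) n+p<)
    where
    n+p< : n + p < suc i * p + suc i
    n+p< = subst (n + p <_) (trans (*-suc (suc i) p) (+-comm (suc i) _))
                 (≰⇒> (<⇒≱ d<i ∘ ≤degBound))

  0<β-degBound : ∀ n → 0 < β (n + p) (degBound p n)
  0<β-degBound n = k≤n⇒0<nCk (m+n≤o⇒m≤o∸n d d+dp≤n+p)
    where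
    d : ℕ
    d = degBound p n
    d+dp≤n+p : d + d * p ≤ n + p
    d+dp≤n+p = subst (_≤ n + p) (*-suc d p) (m/n*n≤m (n + p) (suc p))

  ∑β-pascal : ∀ n k B → ∑[ a < suc B ] (β (suc n + p) a * (a C k))
                      ≡ ∑[ a < suc B ] (β (n + p) a * (a C k)) + ∑[ a < B ] (β n a * (suc a C k))
  -- The a = 0 terms agree because β m 0 reduces to 1.
  ∑β-pascal n k B = begin
    β (suc n + p) 0 * (0 C k) + ∑[ a < B ] (β (suc n + p) (suc a) * (suc a C k))
      ≡⟨ cong (_ +_) (∑<-cong B λ a → cong (_* (suc a C k)) (β-pascal n a)) ⟩
    β (n + p) 0 * (0 C k) + ∑[ a < B ] ((β (n + p) (suc a) + β n a) * (suc a C k))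
      ≡⟨ cong (_ +_) (∑<-cong B λ a → *-distribʳ-+ (suc a C k) (β (n + p) (suc a)) (β n a)) ⟩
    β (n + p) 0 * (0 C k) + ∑[ a < B ] (β (n + p) (suc a) * (suc a C k) + β n a * (suc a C k))
      ≡⟨ cong (_ +_) (∑<-+ B _ _) ⟩
    β (n + p) 0 * (0 C k) + (∑[ a < B ] (β (n + p) (suc a) * (suc a C k))
                             + ∑[ a < B ] (β n a * (suc a C k)))
      ≡⟨ +-assoc (β (n + p) 0 * (0 C k)) _ _ ⟨
    ∑[ a < suc B ] (β (n + p) a * (a C k)) + ∑[ a < B ] (β n a * (suc a C k))
      ∎


  LeadingZeros : ℕ → ∀ {n} → Vec Bool n → Set
  LeadingZeros g v = ∀ j → toℕ j < g → lookup v j ≡ false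

  FibString-∷⁻ : ∀ {n} b {v : Vec Bool n} → FibString p (b ∷ v) → FibString p v
  FibString-∷⁻ b fib i j i<j v[i] v[j] = fib (suc i) (suc j) (s<s i<j) v[i] v[j]

  FibString-0∷ : ∀ {n} {v : Vec Bool n} → FibString p v → FibString p (false ∷ v)
  FibString-0∷ fib (suc i) (suc j) i<j v[i] v[j] = fib i j (s<s⁻¹ i<j) v[i] v[j]

  FibString-1∷ : ∀ {n} {v : Vec Bool n} → LeadingZeros p v → FibString p v → FibString p (true ∷ v)
  FibString-1∷ zeros fib zero    (suc j) _   _    v[j] =
    s≤s (≮⇒≥ λ j<p → contradiction (trans (sym v[j]) (zeros j j<p)) λ ())
  FibString-1∷ zeros fib (suc i) (suc j) i<j v[i] v[j] = fib i j (s<s⁻¹ i<j) v[i] v[j]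

  FibString-1∷⁻ : ∀ {n} {v : Vec Bool n} → FibString p (true ∷ v) → LeadingZeros p v
  FibString-1∷⁻ fib j j<p = ¬-not (λ v[j] → <⇒≱ j<p (s≤s⁻¹ (fib zero (suc j) z<s refl v[j])))

  FibString-downward-closed : ∀ {n} (u v : Vec Bool n) → (∀ i → lookup v i ≡ true → lookup u i ≡ true) →
                   FibString p u → FibString p v
  FibString-downward-closed u v v≤u fib i j i<j v[i] v[j] = fib i j i<j (v≤u i v[i]) (v≤u j v[j])

  -- Fib g v: v is a Fibonacci p-string whose first g letters are 0.
  Fib : ℕ → ∀ {n} → Vec Bool n → Set
  Fib g       []          = ⊤
  Fib zero    (false ∷ v) = Fib zero v
  Fib zero    (true ∷ v)  = Fib p v
  Fib (suc g) (false ∷ v) = Fib g v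
  Fib (suc g) (true ∷ v)  = ⊥

  Fib⇒FibString : ∀ g {n} (v : Vec Bool n) → Fib g v → LeadingZeros g v × FibString p v
  Fib⇒FibString g       []          _   = (λ ()) , (λ ())
  Fib⇒FibString zero    (false ∷ v) fib = (λ _ ()) , FibString-0∷ (proj₂ (Fib⇒FibString zero v fib))
  Fib⇒FibString zero    (true ∷ v)  fib = (λ _ ()) , Product.uncurry FibString-1∷ (Fib⇒FibString p v fib)
  Fib⇒FibString (suc g) (false ∷ v) fib with Fib⇒FibString g v fib
  ... | zeros , fibString = zeros′ , FibString-0∷ fibString
    where
    zeros′ : LeadingZeros (suc g) (false ∷ v)
    zeros′ zero    _   = refl
    zeros′ (suc j) j<g = zeros j (s<s⁻¹ j<g)

  FibString⇒Fib : ∀ g {n} (v : Vec Bool n) → LeadingZeros g v → FibString p v → Fib g v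
  FibString⇒Fib g       []          _     _   = tt
  FibString⇒Fib zero    (false ∷ v) _     fib = FibString⇒Fib zero v (λ _ ()) (FibString-∷⁻ false fib)
  FibString⇒Fib zero    (true ∷ v)  _     fib = FibString⇒Fib p v (FibString-1∷⁻ fib) (FibString-∷⁻ true fib)
  FibString⇒Fib (suc g) (false ∷ v) zeros fib =
    FibString⇒Fib g v (λ j j<g → zeros (suc j) (s<s j<g)) (FibString-∷⁻ false fib)
  FibString⇒Fib (suc g) (true ∷ v)  zeros _   = contradiction (zeros zero z<s) λ ()

  FibPattern : ℕ → ℕ → ∀ {n} → Pattern n → Set
  FibPattern g k w = Fib g (top w) × dim w ≡ k

  fibPatterns : ℕ → (n : ℕ) → ℕ → List (Pattern n)
  fibPatterns g       zero    zero    = [ [] ]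
  fibPatterns g       zero    (suc k) = []
  fibPatterns (suc g) (suc n) k       = List.map (𝟎 ∷_) (fibPatterns g n k)
  fibPatterns zero    (suc n) zero    = List.map (𝟎 ∷_) (fibPatterns 0 n 0) ++ List.map (𝟏 ∷_) (fibPatterns p n 0)
  fibPatterns zero    (suc n) (suc k) = List.map (𝟎 ∷_) (fibPatterns 0 n (suc k))
                                     ++ List.map (𝟏 ∷_) (fibPatterns p n (suc k))
                                     ++ List.map (⋆ ∷_) (fibPatterns p n k)

  ∈-fibPatterns⁺ : ∀ g n k (w : Pattern n) → FibPattern g k w → w ∈ fibPatterns g n k
  ∈-fibPatterns⁺ g       zero    zero    []      _  = here refl
  ∈-fibPatterns⁺ (suc g) (suc n) k       (𝟎 ∷ w) fw = ∈-map⁺ (𝟎 ∷_) (∈-fibPatterns⁺ g n k w fw)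
  ∈-fibPatterns⁺ zero    (suc n) zero    (𝟎 ∷ w) fw = ∈-++⁺ˡ (∈-map⁺ (𝟎 ∷_) (∈-fibPatterns⁺ 0 n 0 w fw))
  ∈-fibPatterns⁺ zero    (suc n) zero    (𝟏 ∷ w) fw = ∈-++⁺ʳ _ (∈-map⁺ (𝟏 ∷_) (∈-fibPatterns⁺ p n 0 w fw))
  ∈-fibPatterns⁺ zero    (suc n) (suc k) (𝟎 ∷ w) fw = ∈-++⁺ˡ (∈-map⁺ (𝟎 ∷_) (∈-fibPatterns⁺ 0 n (suc k) w fw))
  ∈-fibPatterns⁺ zero    (suc n) (suc k) (𝟏 ∷ w) fw =
    ∈-++⁺ʳ (List.map (𝟎 ∷_) (fibPatterns 0 n (suc k)))
      (∈-++⁺ˡ (∈-map⁺ (𝟏 ∷_) (∈-fibPatterns⁺ p n (suc k) w fw)))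
  ∈-fibPatterns⁺ zero    (suc n) (suc k) (⋆ ∷ w) (fib , dim≡) =
    ∈-++⁺ʳ (List.map (𝟎 ∷_) (fibPatterns 0 n (suc k)))
      (∈-++⁺ʳ (List.map (𝟏 ∷_) (fibPatterns p n (suc k)))
        (∈-map⁺ (⋆ ∷_) (∈-fibPatterns⁺ p n k w (fib , suc-injective dim≡))))

  ∈-fibPatterns⁻ : ∀ g n k {w : Pattern n} → w ∈ fibPatterns g n k → FibPattern g k w
  ∈-fibPatterns⁻ g       zero    zero    (here refl) = tt , refl
  ∈-fibPatterns⁻ (suc g) (suc n) k       w∈ with ∈-map⁻ (𝟎 ∷_) w∈
  ... | w , w∈′ , refl = ∈-fibPatterns⁻ g n k w∈′
  ∈-fibPatterns⁻ zero    (suc n) zero    w∈ with ∈-++⁻ (List.map (𝟎 ∷_) (fibPatterns 0 n 0)) w∈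
  ... | inj₁ w∈₀ with ∈-map⁻ (𝟎 ∷_) w∈₀
  ...   | w , w∈′ , refl = ∈-fibPatterns⁻ 0 n 0 w∈′
  ∈-fibPatterns⁻ zero    (suc n) zero    w∈ | inj₂ w∈₁ with ∈-map⁻ (𝟏 ∷_) w∈₁
  ...   | w , w∈′ , refl = ∈-fibPatterns⁻ p n 0 w∈′
  ∈-fibPatterns⁻ zero    (suc n) (suc k) w∈ with ∈-++⁻ (List.map (𝟎 ∷_) (fibPatterns 0 n (suc k))) w∈
  ... | inj₁ w∈₀ with ∈-map⁻ (𝟎 ∷_) w∈₀
  ...   | w , w∈′ , refl = ∈-fibPatterns⁻ 0 n (suc k) w∈′
  ∈-fibPatterns⁻ zero    (suc n) (suc k) w∈ | inj₂ w∈₁⋆ with ∈-++⁻ (List.map (𝟏 ∷_) (fibPatterns p n (suc k))) w∈₁⋆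
  ... | inj₁ w∈₁ with ∈-map⁻ (𝟏 ∷_) w∈₁
  ...   | w , w∈′ , refl = ∈-fibPatterns⁻ p n (suc k) w∈′
  ∈-fibPatterns⁻ zero    (suc n) (suc k) w∈ | inj₂ _ | inj₂ w∈⋆ with ∈-map⁻ (⋆ ∷_) w∈⋆
  ...   | w , w∈′ , refl = Product.map₂ (cong suc) (∈-fibPatterns⁻ p n k w∈′)

  private
    Unique-map-∷ : ∀ {n} l {ws : List (Pattern n)} → Unique ws → Unique (List.map (l ∷_) ws)
    Unique-map-∷ l = Unique.map⁺ ∷-injectiveʳ

    Disjoint-map-∷ : ∀ {n} {l l′} (ws ws′ : List (Pattern n)) → l ≢ l′ →
                     Disjoint (List.map (l ∷_) ws) (List.map (l′ ∷_) ws′)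
    Disjoint-map-∷ ws ws′ l≢l′ (w∈ , w∈′) with ∈-map⁻ _ w∈ | ∈-map⁻ _ w∈′
    ... | _ , _ , refl | _ , _ , eq = l≢l′ (proj₁ (∷-injective eq))

    Disjoint-++ : ∀ {n} {us : List (Pattern n)} vs {ws} → Disjoint us vs → Disjoint us ws → Disjoint us (vs ++ ws)
    Disjoint-++ vs us#vs us#ws (w∈us , w∈vs++ws) with ∈-++⁻ vs w∈vs++ws
    ... | inj₁ w∈vs = us#vs (w∈us , w∈vs)
    ... | inj₂ w∈ws = us#ws (w∈us , w∈ws)

  fibPatterns-unique : ∀ g n k → Unique (fibPatterns g n k)
  fibPatterns-unique g       zero    zero    = [] ∷ []
  fibPatterns-unique g       zero    (suc k) = []
  fibPatterns-unique (suc g) (suc n) k       = Unique-map-∷ 𝟎 (fibPatterns-unique g n k)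
  fibPatterns-unique zero    (suc n) zero    =
    Unique.++⁺ (Unique-map-∷ 𝟎 (fibPatterns-unique 0 n 0)) (Unique-map-∷ 𝟏 (fibPatterns-unique p n 0))
               (Disjoint-map-∷ _ _ λ ())
  fibPatterns-unique zero    (suc n) (suc k) =
    Unique.++⁺ (Unique-map-∷ 𝟎 (fibPatterns-unique 0 n (suc k)))
      (Unique.++⁺ (Unique-map-∷ 𝟏 (fibPatterns-unique p n (suc k))) (Unique-map-∷ ⋆ (fibPatterns-unique p n k))
                  (Disjoint-map-∷ _ _ λ ()))
      (Disjoint-++ (List.map (𝟏 ∷_) (fibPatterns p n (suc k))) (Disjoint-map-∷ _ _ λ ()) (Disjoint-map-∷ _ _ λ ()))

  length-fibPatterns : ∀ g n k B → n < B →
                       length (fibPatterns g n k) ≡ ∑[ a < B ] (β (n + p ∸ g) a * (a C k))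
  length-fibPatterns g       zero    zero    (suc B) _   =
    cong suc (sym (∑<-zero B λ a → cong (_* 1) (β-short (m∸n≤m p g) a)))
  length-fibPatterns g       zero    (suc k) (suc B) _   =
    sym (∑<-zero B λ a → cong (_* (suc a C suc k)) (β-short (m∸n≤m p g) a))
  length-fibPatterns (suc g) (suc n) k       B       n<B =
    trans (length-map (𝟎 ∷_) (fibPatterns g n k)) (length-fibPatterns g n k B (<-trans (n<1+n n) n<B))
  length-fibPatterns zero    (suc n) k       (suc B) n<B = begin
    length (fibPatterns 0 (suc n) k)
      ≡⟨ split k ⟩
    length (fibPatterns 0 n k) + ∑[ a < B ] (β n a * (suc a C k))
      ≡⟨ cong (_+ ∑[ a < B ] (β n a * (suc a C k))) (length-fibPatterns 0 n k (suc B) (<-trans (n<1+n n) n<B)) ⟩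
    ∑[ a < suc B ] (β (n + p) a * (a C k)) + ∑[ a < B ] (β n a * (suc a C k))
      ≡⟨ ∑β-pascal n k B ⟨
    ∑[ a < suc B ] (β (suc n + p) a * (a C k))
      ∎
    where
    shifted : ∀ k → length (fibPatterns p n k) ≡ ∑[ a < B ] (β n a * (a C k))
    shifted k = trans (length-fibPatterns p n k B (s<s⁻¹ n<B))
                      (cong (λ m → ∑[ a < B ] (β m a * (a C k))) (m+n∸n≡m n p))
    split : ∀ k → length (fibPatterns 0 (suc n) k)
                ≡ length (fibPatterns 0 n k) + ∑[ a < B ] (β n a * (suc a C k))
    split zero    = trans (length-++ (List.map (𝟎 ∷_) (fibPatterns 0 n 0)))
      (cong₂ _+_ (length-map (𝟎 ∷_) (fibPatterns 0 n 0)) (trans (length-map (𝟏 ∷_) (fibPatterns p n 0)) (shifted 0)))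
    split (suc k) = trans (length-++ (List.map (𝟎 ∷_) (fibPatterns 0 n (suc k))))
      (cong₂ _+_ (length-map (𝟎 ∷_) (fibPatterns 0 n (suc k))) (begin
        length (List.map (𝟏 ∷_) (fibPatterns p n (suc k)) ++ List.map (⋆ ∷_) (fibPatterns p n k))
          ≡⟨ length-++ (List.map (𝟏 ∷_) (fibPatterns p n (suc k))) ⟩
        length (List.map (𝟏 ∷_) (fibPatterns p n (suc k))) + length (List.map (⋆ ∷_) (fibPatterns p n k))
          ≡⟨ cong₂ _+_ (trans (length-map (𝟏 ∷_) (fibPatterns p n (suc k))) (shifted (suc k)))
                       (trans (length-map (⋆ ∷_) (fibPatterns p n k)) (shifted k)) ⟩
        ∑[ a < B ] (β n a * (a C suc k)) + ∑[ a < B ] (β n a * (a C k))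
          ≡⟨ ∑-*-pascal B (β n) k ⟨
        ∑[ a < B ] (β n a * (suc a C suc k))
          ∎))

  FibPattern⇒InducedQk : ∀ {n k} (w : Pattern n) → FibPattern 0 k w → InducedQk p n k ⟦ w ⟧
  FibPattern⇒InducedQk w (fib , refl) =
    (λ v v∈ → FibString-downward-closed (top w) v (∈ᴾ⇒≤top (∈V⟦⟧⇒∈ᴾ w v v∈)) (proj₂ (Fib⇒FibString 0 (top w) fib))) ,
    embed w ,
    (λ x → ∈ᴾ⇒∈V⟦⟧ (embed-∈ᴾ w x)) ,
    (λ v v∈ → embed-surjective (∈V⟦⟧⇒∈ᴾ w v v∈)) ,
    (λ x y → embed-injective w) ,
    (λ x y → mk⇔ (trans (hamming-embed w x y)) (trans (sym (hamming-embed w x y))))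

  InducedQk⇒FibPattern : ∀ {n k} S → InducedQk p n k S → ∃ λ w → FibPattern 0 k w × S ≡ ⟦ w ⟧
  InducedQk⇒FibPattern {k = k} S (fib , f , f∈S , S⊆image , f-injective , f-adj)
    with cube-image k f (f-injective _ _) (λ x y → Equivalence.to (f-adj x y))
  ... | w , dim-w , image-w =
    w , (FibString⇒Fib 0 (top w) (λ _ ()) (fib (top w) (⟦w⟧⊆S (top w) (∈ᴾ⇒∈V⟦⟧ (top-∈ᴾ w)))) , dim-w) ,
    VSet-ext S ⟦ w ⟧ S⊆⟦w⟧ ⟦w⟧⊆S
    where
    ⟦w⟧⊆S : ∀ v → v ∈V ⟦ w ⟧ → v ∈V S
    ⟦w⟧⊆S v v∈ with Equivalence.to (image-w v) (∈V⟦⟧⇒∈ᴾ w v v∈)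
    ... | x , refl = f∈S x
    S⊆⟦w⟧ : ∀ v → v ∈V S → v ∈V ⟦ w ⟧
    S⊆⟦w⟧ v v∈ = ∈ᴾ⇒∈V⟦⟧ (Equivalence.from (image-w v) (S⊆image v v∈))

  cCount-fibPatterns : ∀ n k → cCount p n k (length (fibPatterns 0 n k))
  cCount-fibPatterns n k = CountIs-map ⟦_⟧ (⟦⟧-injective _ _) (fibPatterns-unique 0 n k)
    (λ {w} w∈ → FibPattern⇒InducedQk w (∈-fibPatterns⁻ 0 n k w∈))
    (λ {S} S-cube → Product.map₂ (Product.map₁ (∈-fibPatterns⁺ 0 n k _)) (InducedQk⇒FibPattern S S-cube))

  module _ (n : ℕ) where

    private
      d : ℕ
      d = degBound p n

      βC : ℕ → ℕ → ℕ
      βC k a = β (n + p) a * (a C k)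

    length-fibPatterns≡∑ : ∀ k → length (fibPatterns 0 n k) ≡ ∑[ a < suc d ] βC k a
    length-fibPatterns≡∑ k = trans (length-fibPatterns 0 n k (suc d + n) (s≤s (m≤n+m n d)))
      (∑<-vanishing-tail (suc d) (suc d + n) (βC k) (m≤m+n (suc d) n)
                         (λ a d<a → cong (_* (a C k)) (β-vanishes-above-degBound n a d<a)))

    ckRHS≡∑ : ∀ k → ckRHS p n k ≡ ∑[ a < suc d ] βC k a
    ckRHS≡∑ k = sym (∑<-vanishing-head k (suc d) (βC k)
                      (λ a a<k → trans (cong (β (n + p) a *_) (k>n⇒nCk≡0 a<k)) (*-zeroʳ (β (n + p) a))))

    cCount-ckRHS : ∀ k → cCount p n k (ckRHS p n k)
    cCount-ckRHS k =
      subst (cCount p n k) (trans (length-fibPatterns≡∑ k) (sym (ckRHS≡∑ k))) (cCount-fibPatterns n k)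

    coeff-cubePolyRHS≡∑ : ∀ k → coeff (cubePolyRHS p n) k ≡ ∑[ a < suc d ] βC k a
    coeff-cubePolyRHS≡∑ k = trans (coeff-polySumTo d _ k) (∑<-cong (suc d) λ a →
      trans (coeff-scaleP (β (n + p) a) (onePlusXPow a) k) (cong (β (n + p) a *_) (coeff-onePlusXPow a k)))

    ckRHS-vanishes-above-degBound : ∀ k → d < k → ckRHS p n k ≡ 0
    ckRHS-vanishes-above-degBound k d<k = cong (λ m → ∑[ j < m ] βC k (k + j)) (m≤n⇒m∸n≡0 d<k)

    ckRHS-degBound : ckRHS p n d ≡ β (n + p) d
    ckRHS-degBound = begin
      ∑[ j < suc d ∸ d ] βC d (d + j)   ≡⟨ cong (λ m → ∑[ j < m ] βC d (d + j)) (m+n∸n≡m 1 d) ⟩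
      βC d (d + 0) + 0                  ≡⟨ +-identityʳ _ ⟩
      βC d (d + 0)                      ≡⟨ cong (βC d) (+-identityʳ d) ⟩
      β (n + p) d * (d C d)             ≡⟨ cong (β (n + p) d *_) (nCn≡1 d) ⟩
      β (n + p) d * 1                   ≡⟨ *-identityʳ _ ⟩
      β (n + p) d                       ∎

theorem3p1 : (p n : ℕ) → 1 ≤ p →
    -- C_{Γ_n^p}(x) = Σ_{a=0}^{d} binom(n-ap+p,a)(1+x)^a  (coefficientwise)
    ((k : ℕ) → cCount p n k (coeff (cubePolyRHS p n) k)) ×
    -- degree of C_{Γ_n^p} is d = ⌊(n+p)/(p+1)⌋
    ((k : ℕ) → degBound p n < k → cCount p n k 0) ×
    Σ ℕ (λ m → cCount p n (degBound p n) m × m ≢ 0) ×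
    -- c_k(Γ_n^p) = Σ_{i=k}^{d} binom(n-ip+p,i) binom(i,k)
    ((k : ℕ) → cCount p n k (ckRHS p n k))
theorem3p1 p n _ =
  (λ k → subst (cCount p n k) (trans (ckRHS≡∑ p n k) (sym (coeff-cubePolyRHS≡∑ p n k))) (cCount-ckRHS p n k)) ,
  (λ k d<k → subst (cCount p n k) (ckRHS-vanishes-above-degBound p n k d<k) (cCount-ckRHS p n k)) ,
  (ckRHS p n d , cCount-ckRHS p n d , subst (_≢ 0) (sym (ckRHS-degBound p n)) (m<n⇒n≢0 (0<β-degBound p n))) ,
  cCount-ckRHS p n
  where
  d : ℕ
  d = degBound p n
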